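{- Let $N = p^k m^2$ be an odd perfect number given in Eulerian form, and suppose $m^2 - p^k = 2^r t$ where $r \geq 2$ is an integer and $t$ is a positive integer with $\gcd(2,t) = 1$. (1) If $m > t > 2^r$, then $m < p^k$. (2) If $m > 2^r > t$, then $m < p^k$.
   Context: A positive integer $N$ is an odd perfect number if $N$ is odd and $\sigma(N) = 2N$, where $\sigma$ denotes the sum-of-divisors function. An odd perfect number is said to be given in Eulerian form $N = p^k m^2$ if $p$ is a prime (the special prime), $k$ and $m$ are positive integers, $p \equiv k \equiv 1 \pmod 4$, and $\gcd(p,m) = 1$. -}

module Defs where

open import Data.Nat using (ℕ; suc; _+_; _*_; _^_; _%_; _≤_)
open import Data.Nat.Divisibility using (_∣_; _∣?_)
open import Data.Nat.GCD using (gcd)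
open import Data.Nat.Primality using (Prime)
open import Data.List using (List; filter; upTo; map)
open import Data.Nat.ListAction using (sum)
open import Data.Product using (_×_; Σ)
open import Relation.Binary.PropositionalEquality using (_≡_)

divisors : ℕ → List ℕ
divisors n = filter (_∣? n) (map suc (upTo n))

σ : ℕ → ℕ
σ n = sum (divisors n)

Odd : ℕ → Set
Odd n = n % 2 ≡ 1

OddPerfect : ℕ → Set
OddPerfect N = Odd N × σ N ≡ 2 * N

EulerianForm : ℕ → ℕ → ℕ → ℕ → Set
EulerianForm N p k m =
  OddPerfect N × N ≡ p ^ k * (m ^ 2) × Prime p ×
  (1 ≤ k) × (1 ≤ m) ×
  p % 4 ≡ 1 × k % 4 ≡ 1 × gcd p m ≡ 1

{-# OPTIONS --safe #-}
module Submission where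

-- Only the factorisation m² = pᵏ + 2ʳ t matters: write it as m² = P + a b with b < a < m
-- (so {a, b} = {t, 2ʳ}). If P ≤ m, then m² ≤ m + (m − 1)(m − 2) = m² − 2(m − 1) < m²,
-- a contradiction; hence m < P.

open import Defs
open import Data.Nat using (ℕ; _^_; _*_; _<_; _≤_; _+_; suc; zero; s≤s; z≤n)
open import Data.Nat.GCD using (gcd)
open import Data.Nat.Properties
  using (_<?_; ≮⇒≥; ≤-pred; ≤-trans; +-mono-≤; *-mono-≤; m≤m+n; <-irrefl; +-comm; *-comm; *-identityʳ; module ≤-Reasoning)
open import Data.Nat.Tactic.RingSolver using (solve-∀)
open import Data.Integer using (+_; _-_)
import Data.Integer as ℤ
import Data.Integer.Properties as ℤ
open import Algebra.Properties.AbelianGroup ℤ.+-0-abelianGroup using (//-rightDividesˡ)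
open import Data.Product using (_×_; _,_)
open import Relation.Binary.PropositionalEquality using (_≡_; refl; sym; trans; cong; module ≡-Reasoning)
open import Relation.Nullary using (yes; no; contradiction)

+m-+n≡+o⇒m≡n+o : ∀ {m n o} → + m - + n ≡ + o → m ≡ n + o
+m-+n≡+o⇒m≡n+o {m} {n} {o} eq = ℤ.+-injective (begin
  + m                    ≡⟨ //-rightDividesˡ (+ n) (+ m) ⟨
  (+ m - + n) ℤ.+ + n    ≡⟨ cong (ℤ._+ + n) eq ⟩
  + o ℤ.+ + n            ≡⟨ ℤ.+-comm (+ o) (+ n) ⟩
  + (n + o)              ∎)
  where open ≡-Reasoning

[1+n]*n+[2+n]<[2+n]*[2+n] : ∀ n → suc n * n + suc (suc n) < suc (suc n) * suc (suc n)
[1+n]*n+[2+n]<[2+n]*[2+n] n = begin-strict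
  suc n * n + suc (suc n)                    <⟨ s≤s (m≤m+n _ (suc (n + n))) ⟩
  suc (suc n * n + suc (suc n) + suc (n + n)) ≡⟨ identity n ⟩
  suc (suc n) * suc (suc n)                  ∎
  where
  open ≤-Reasoning
  identity : ∀ n → suc (suc n * n + suc (suc n) + suc (n + n)) ≡ suc (suc n) * suc (suc n)
  identity = solve-∀

square≡+*⇒< : ∀ {m P a b} → m * m ≡ P + a * b → b < a → a < m → m < P
square≡+*⇒< {zero}          _  _   ()
square≡+*⇒< {suc zero}      _  ()  (s≤s z≤n)
square≡+*⇒< {suc (suc n)} {P} {a} {b} eq b<a (s≤s a≤1+n) with suc (suc n) <? P
... | yes m<P = m<P
... | no  m≮P = contradiction m*m<m*m (<-irrefl refl)
  where
  open ≤-Reasoning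
  m = suc (suc n)
  b≤n : b ≤ n
  b≤n = ≤-pred (≤-trans b<a a≤1+n)
  m*m<m*m : m * m < m * m
  m*m<m*m = begin-strict
    m * m          ≡⟨ eq ⟩
    P + a * b      ≤⟨ +-mono-≤ (≮⇒≥ m≮P) (*-mono-≤ a≤1+n b≤n) ⟩
    m + suc n * n  ≡⟨ +-comm m (suc n * n) ⟩
    suc n * n + m  <⟨ [1+n]*n+[2+n]<[2+n]*[2+n] n ⟩
    m * m          ∎

theorem4 : (N p k m r t : ℕ) → EulerianForm N p k m →
    (+ (m ^ 2)) - (+ (p ^ k)) ≡ + (2 ^ r * t) →
    2 ≤ r → 0 < t → gcd 2 t ≡ 1 →
    ((t < m × 2 ^ r < t → m < p ^ k) × (2 ^ r < m × t < 2 ^ r → m < p ^ k))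
theorem4 N p k m r t _ m²-pᵏ≡2ʳt _ _ _ =
    (λ (t<m , 2ʳ<t) → square≡+*⇒< m*m≡pᵏ+t*2ʳ 2ʳ<t t<m)
  , (λ (2ʳ<m , t<2ʳ) → square≡+*⇒< m*m≡pᵏ+2ʳ*t t<2ʳ 2ʳ<m)
  where
  m*m≡pᵏ+2ʳ*t : m * m ≡ p ^ k + 2 ^ r * t
  m*m≡pᵏ+2ʳ*t = trans (cong (m *_) (sym (*-identityʳ m))) (+m-+n≡+o⇒m≡n+o m²-pᵏ≡2ʳt)
  m*m≡pᵏ+t*2ʳ : m * m ≡ p ^ k + t * 2 ^ r
  m*m≡pᵏ+t*2ʳ = trans m*m≡pᵏ+2ʳ*t (cong (λ x → p ^ k + x) (*-comm (2 ^ r) t))
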